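{- Let $T,U$ be independent indeterminates and $C:=\mathbb{Q}(T,U)$. Define $h_0:=T$, $h_{n+1}:=h_n^2-2U^{2^n}$ ($n\ge0$), and $S_n(T,U):=\sum_{0\le m\le n}\frac{U^{2^m}}{h_0h_1\cdots h_m}\in C$. Let $F(X):=\frac{X^2-U}{2X-T}\in C(X)$ (the Newton iterator of $X^2-TX+U$), $F^{(0)}(X):=X$, and $F^{(n)}$ its $n$-fold iterate. Then for all $n\ge0$, $$F^{(n+1)}(0)=S_n(T,U),\qquad F^{(n+1)}(T)=T-S_n(T,U)$$ as elements of $C$. -}

module Defs where

open import Data.Nat using (ℕ; zero; suc; _^_)
open import Data.Rational as Q using (ℚ; 0ℚ; 1ℚ)
open import Data.Rational.Properties using () renaming (_≟_ to _≟ℚ_)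
open import Data.List using (List; []; _∷_; map)
open import Data.List.Relation.Unary.All using (All; all?)
open import Data.Maybe using (Maybe; just; nothing; _>>=_)
open import Data.Empty using (⊥)
open import Relation.Binary.PropositionalEquality using (_≡_)
open import Relation.Nullary using (yes; no; Dec)

-- Dense polynomials over a coefficient "ring" given by its operations.
-- A polynomial is the list of its coefficients, lowest degree first.

module PolyOps {A : Set} (0A : A) (_+A_ _*A_ : A → A → A) where

  addP : List A → List A → List A
  addP []       q        = q
  addP (a ∷ p)  []       = a ∷ p
  addP (a ∷ p)  (b ∷ q)  = (a +A b) ∷ addP p q

  mulP : List A → List A → List A
  mulP []      q = []
  mulP (a ∷ p) q = addP (map (a *A_) q) (0A ∷ mulP p q)

PT : Set
PT = List ℚ

open PolyOps 0ℚ Q._+_ Q._*_ public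
  renaming (addP to _+T_; mulP to _*T_)

negT : PT → PT
negT = map (λ r → Q.- r)

-- ℚ[T,U] = ℚ[T][U] : coefficient lists in U over ℚ[T].

P2 : Set
P2 = List PT

open PolyOps [] _+T_ _*T_ public
  renaming (addP to _+P_; mulP to _*P_)

negP : P2 → P2
negP = map negT

_-P_ : P2 → P2 → P2
p -P q = p +P negP q

IsZeroP : P2 → Set
IsZeroP p = All (All (_≡ 0ℚ)) p

isZeroP? : (p : P2) → Dec (IsZeroP p)
isZeroP? = all? (all? (_≟ℚ 0ℚ))

-- C = ℚ(T,U) : fractions num/den of elements of ℚ[T,U].
-- All fractions arising below have nonzero denominator (they are built
-- from constants and by division only by elements with nonzero numerator).

record C : Set where
  constructor _⁄_
  field
    num : P2
    den : P2
open C public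

_≈C_ : C → C → Set
x ≈C y = IsZeroP ((num x *P den y) -P (num y *P den x))

constC : ℚ → C
constC r = ((r ∷ []) ∷ []) ⁄ ((1ℚ ∷ []) ∷ [])

0C 1C 2C : C
0C = constC 0ℚ
1C = constC 1ℚ
2C = constC (Q._+_ 1ℚ 1ℚ)

Tc : C
Tc = ((0ℚ ∷ 1ℚ ∷ []) ∷ []) ⁄ ((1ℚ ∷ []) ∷ [])

Uc : C
Uc = ([] ∷ (1ℚ ∷ []) ∷ []) ⁄ ((1ℚ ∷ []) ∷ [])

infixl 6 _+C_ _-C_
infixl 7 _*C_

_+C_ : C → C → C
(a ⁄ b) +C (c ⁄ d) = ((a *P d) +P (c *P b)) ⁄ (b *P d)

_-C_ : C → C → C
(a ⁄ b) -C (c ⁄ d) = ((a *P d) -P (c *P b)) ⁄ (b *P d)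

_*C_ : C → C → C
(a ⁄ b) *C (c ⁄ d) = (a *P c) ⁄ (b *P d)

_^C_ : C → ℕ → C
x ^C zero  = 1C
x ^C suc n = x *C (x ^C n)

_/C_ : C → C → Maybe C
(a ⁄ b) /C (c ⁄ d) with isZeroP? c
... | yes _ = nothing
... | no  _ = just ((a *P d) ⁄ (b *P c))

_≈M_ : Maybe C → Maybe C → Set
just x  ≈M just y  = x ≈C y
just _  ≈M nothing = ⊥
nothing ≈M _       = ⊥

h : ℕ → C
h zero    = Tc
h (suc n) = (h n *C h n) -C (2C *C (Uc ^C (2 ^ n)))

hprod : ℕ → C
hprod zero    = h zero
hprod (suc m) = hprod m *C h (suc m)

S : ℕ → Maybe C
S zero    = (Uc ^C (2 ^ 0)) /C hprod zero
S (suc n) = S n >>= λ s → ((Uc ^C (2 ^ suc n)) /C hprod (suc n)) >>= λ t → just (s +C t)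

F : C → Maybe C
F x = ((x *C x) -C Uc) /C ((2C *C x) -C Tc)

Fiter : ℕ → C → Maybe C
Fiter zero    x = just x
Fiter (suc n) x = Fiter n x >>= F

-- Write s = S n, P = h₀ ⋯ hₙ and V = U ^ (2 ^ (n + 1)). Inductively s is an approximate
-- root of X² - T X + U in the sense that s² - T s + U = V / P² and 2 s - T = - hₙ₊₁ / P.
-- Hence the Newton step F(s) = s - (s² - T s + U) / (2 s - T) adds exactly t = V / (P hₙ₊₁),
-- the next summand of S, and both relations persist: the new residual is t², and
-- hₙ₊₂ = hₙ₊₁² - 2 V gives the new slope. As X² - T X + U is invariant under X ↦ T - X, so is
-- Newton's method, F(T - x) = T - F(x), which turns the orbit of 0 into the orbit of T.
-- We compute in the field of fractions of ℚ[T][U], where all denominators are nonzero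
-- because hₙ ≡ T ^ (2 ^ n) modulo U.

module Submission where

open import Defs
open import Data.Nat using (ℕ; suc)
open import Data.Product using (_×_)
open import Data.Maybe using (map)

open import Algebra.Bundles using (CommutativeRing)
open import Algebra.Definitions using (AlmostRightCancellative)
open import Algebra.Structures using (IsCommutativeRing)
open import Data.Integer using (+_)
open import Data.List as List using (List; []; _∷_)
open import Data.List.Relation.Unary.All as All using (All; []; _∷_; all?)
open import Data.Maybe using (Maybe; just; nothing; _>>=_)
open import Data.Nat as ℕ using (zero)
import Data.Nat.Properties as ℕ
open import Data.Product using (_,_; Σ-syntax)
open import Data.Rational as ℚ using (0ℚ; 1ℚ; 1/_; ≢-nonZero)
import Data.Rational.Properties as ℚ
open import Level using (0ℓ; _⊔_)
open import Relation.Binary.Bundles using (Setoid)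
open import Relation.Binary.PropositionalEquality as ≡ using (_≡_)
open import Relation.Nullary using (¬_; Dec; yes; no; map′; contradiction)

module IntegerCoefficients {c ℓ} (R : CommutativeRing c ℓ) where

  open import Data.Integer as ℤ using (ℤ; -[1+_]; _⊖_)
  import Data.Integer.Properties as ℤ
  open CommutativeRing R
  open import Algebra.Properties.Ring ring using (-0#≈0#; -‿involutive; -‿+-comm; -‿distribˡ-*; -‿distribʳ-*)
  open import Algebra.Properties.Semiring.Mult.TCOptimised semiring using (×-homo-+; ×1-homo-*) renaming (_×_ to _·_)
  import Algebra.Solver.CommutativeMonoid +-commutativeMonoid as +-Solver
  open import Algebra.Solver.Ring.AlmostCommutativeRing using (fromCommutativeRing; _-Raw-AlmostCommutative⟶_)
  open import Relation.Binary.Reasoning.Setoid setoid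

  ⟦_⟧ℤ : ℤ → Carrier
  ⟦ + n ⟧ℤ      = n · 1#
  ⟦ -[1+ n ] ⟧ℤ = - (suc n · 1#)

  ⟦⟧ℤ-cong : ∀ {i j} → i ≡ j → ⟦ i ⟧ℤ ≈ ⟦ j ⟧ℤ
  ⟦⟧ℤ-cong ≡.refl = refl

  suc·1# : ∀ n → suc n · 1# ≈ 1# + n · 1#
  suc·1# n = ×-homo-+ 1# 1 n

  ⟦⟧ℤ-neg : ∀ i → ⟦ ℤ.- i ⟧ℤ ≈ - ⟦ i ⟧ℤ
  ⟦⟧ℤ-neg (+ zero)  = sym -0#≈0#
  ⟦⟧ℤ-neg (+ suc n) = refl
  ⟦⟧ℤ-neg -[1+ n ]  = sym (-‿involutive _)

  ⟦⟧ℤ-⊖ : ∀ m n → ⟦ m ⊖ n ⟧ℤ ≈ m · 1# - n · 1#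
  ⟦⟧ℤ-⊖ zero    zero    = sym (-‿inverseʳ 0#)
  ⟦⟧ℤ-⊖ zero    (suc n) = sym (+-identityˡ _)
  ⟦⟧ℤ-⊖ (suc m) zero    = sym (trans (+-congˡ -0#≈0#) (+-identityʳ _))
  ⟦⟧ℤ-⊖ (suc m) (suc n) = begin
    ⟦ suc m ⊖ suc n ⟧ℤ              ≈⟨ ⟦⟧ℤ-cong (ℤ.[1+m]⊖[1+n]≡m⊖n m n) ⟩
    ⟦ m ⊖ n ⟧ℤ                      ≈⟨ ⟦⟧ℤ-⊖ m n ⟩
    a - b                           ≈⟨ shift ⟩
    (1# + a) - (1# + b)             ≈⟨ +-cong (suc·1# m) (-‿cong (suc·1# n)) ⟨
    suc m · 1# - suc n · 1#         ∎
    where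
    open +-Solver using (solve; _⊕_; _⊜_)
    a b : Carrier
    a = m · 1#
    b = n · 1#
    shift : a - b ≈ (1# + a) - (1# + b)
    shift = begin
      a - b                         ≈⟨ +-identityˡ _ ⟨
      0# + (a - b)                  ≈⟨ +-congʳ (-‿inverseʳ 1#) ⟨
      (1# - 1#) + (a - b)           ≈⟨ solve 4 (λ o a mo mb → (o ⊕ mo) ⊕ (a ⊕ mb) ⊜ (o ⊕ a) ⊕ (mo ⊕ mb)) refl 1# a (- 1#) (- b) ⟩
      (1# + a) + (- 1# - b)         ≈⟨ +-congˡ (-‿+-comm 1# b) ⟩
      (1# + a) - (1# + b)           ∎

  ⟦⟧ℤ-+ : ∀ i j → ⟦ i ℤ.+ j ⟧ℤ ≈ ⟦ i ⟧ℤ + ⟦ j ⟧ℤ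
  ⟦⟧ℤ-+ (+ m)    (+ n)    = ×-homo-+ 1# m n
  ⟦⟧ℤ-+ (+ m)    -[1+ n ] = ⟦⟧ℤ-⊖ m (suc n)
  ⟦⟧ℤ-+ -[1+ m ] (+ n)    = trans (⟦⟧ℤ-⊖ n (suc m)) (+-comm _ _)
  ⟦⟧ℤ-+ -[1+ m ] -[1+ n ] = begin
    - (suc (suc (m ℕ.+ n)) · 1#)          ≈⟨ -‿cong (reflexive (≡.cong (λ k → suc k · 1#) (ℕ.+-suc m n))) ⟨
    - (suc (m ℕ.+ suc n) · 1#)            ≈⟨ -‿cong (×-homo-+ 1# (suc m) (suc n)) ⟩
    - (suc m · 1# + suc n · 1#)           ≈⟨ -‿+-comm _ _ ⟨
    - (suc m · 1#) - (suc n · 1#)         ∎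

  ⟦⟧ℤ-*⁺ : ∀ m j → ⟦ + m ℤ.* j ⟧ℤ ≈ m · 1# * ⟦ j ⟧ℤ
  ⟦⟧ℤ-*⁺ m (+ n)    = trans (⟦⟧ℤ-cong (ℤ.+◃n≡+n (m ℕ.* n))) (×1-homo-* m n)
  ⟦⟧ℤ-*⁺ m -[1+ n ] = begin
    ⟦ + m ℤ.* -[1+ n ] ⟧ℤ            ≈⟨ ⟦⟧ℤ-cong (ℤ.neg-distribʳ-* (+ m) (+ suc n)) ⟨
    ⟦ ℤ.- (+ m ℤ.* + suc n) ⟧ℤ       ≈⟨ ⟦⟧ℤ-neg (+ m ℤ.* + suc n) ⟩
    - ⟦ + m ℤ.* + suc n ⟧ℤ           ≈⟨ -‿cong (⟦⟧ℤ-*⁺ m (+ suc n)) ⟩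
    - (m · 1# * suc n · 1#)          ≈⟨ -‿distribʳ-* _ _ ⟩
    m · 1# * - (suc n · 1#)          ∎

  ⟦⟧ℤ-* : ∀ i j → ⟦ i ℤ.* j ⟧ℤ ≈ ⟦ i ⟧ℤ * ⟦ j ⟧ℤ
  ⟦⟧ℤ-* (+ m)    j = ⟦⟧ℤ-*⁺ m j
  ⟦⟧ℤ-* -[1+ m ] j = begin
    ⟦ -[1+ m ] ℤ.* j ⟧ℤ              ≈⟨ ⟦⟧ℤ-cong (ℤ.neg-distribˡ-* (+ suc m) j) ⟨
    ⟦ ℤ.- (+ suc m ℤ.* j) ⟧ℤ         ≈⟨ ⟦⟧ℤ-neg (+ suc m ℤ.* j) ⟩
    - ⟦ + suc m ℤ.* j ⟧ℤ             ≈⟨ -‿cong (⟦⟧ℤ-*⁺ (suc m) j) ⟩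
    - (suc m · 1# * ⟦ j ⟧ℤ)          ≈⟨ -‿distribˡ-* _ _ ⟩
    - (suc m · 1#) * ⟦ j ⟧ℤ          ∎

  ⟦⟧ℤ-morphism : ℤ.+-*-rawRing -Raw-AlmostCommutative⟶ fromCommutativeRing R
  ⟦⟧ℤ-morphism = record
    { ⟦_⟧    = ⟦_⟧ℤ
    ; +-homo = ⟦⟧ℤ-+
    ; *-homo = ⟦⟧ℤ-*
    ; -‿homo = ⟦⟧ℤ-neg
    ; 0-homo = refl
    ; 1-homo = refl
    }

  ⟦⟧ℤ-≟ : ∀ i j → Maybe (⟦ i ⟧ℤ ≈ ⟦ j ⟧ℤ)
  ⟦⟧ℤ-≟ i j with i ℤ.≟ j
  ... | yes i≡j = just (⟦⟧ℤ-cong i≡j)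
  ... | no  _   = nothing

  open import Algebra.Solver.Ring ℤ.+-*-rawRing (fromCommutativeRing R) ⟦⟧ℤ-morphism ⟦⟧ℤ-≟ public

module ZeroDivisors {c ℓ} (R : CommutativeRing c ℓ) where

  open CommutativeRing R
  open import Algebra.Properties.Ring ring using (-0#≈0#; -‿involutive; x∙y⁻¹≈ε⇒x≈y; x≈y⇒x∙y⁻¹≈ε; [y-z]x≈yx-zx)

  *-≉0ˡ : ∀ {x y} → x * y ≉ 0# → x ≉ 0#
  *-≉0ˡ {x} {y} xy≉0 x≈0 = xy≉0 (trans (*-congʳ x≈0) (zeroˡ y))

  -‿≉0 : ∀ {x} → x ≉ 0# → - x ≉ 0#
  -‿≉0 {x} x≉0 -x≈0 = x≉0 (trans (sym (-‿involutive x)) (trans (-‿cong -x≈0) -0#≈0#))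

  zero-product⇒almostCancelʳ : (∀ {x y} → x * y ≈ 0# → y ≉ 0# → x ≈ 0#) → AlmostRightCancellative _≈_ 0# _*_
  zero-product⇒almostCancelʳ zero-product x y z x≉0 yx≈zx =
    x∙y⁻¹≈ε⇒x≈y y z (zero-product (trans ([y-z]x≈yx-zx x y z) (x≈y⇒x∙y⁻¹≈ε yx≈zx)) x≉0)

  module _ (cancel : AlmostRightCancellative _≈_ 0# _*_) where

    zero-product : ∀ {x y} → x * y ≈ 0# → y ≉ 0# → x ≈ 0#
    zero-product {x} {y} xy≈0 y≉0 = cancel y x 0# y≉0 (trans xy≈0 (sym (zeroˡ y)))

    *-≉0 : ∀ {x y} → x ≉ 0# → y ≉ 0# → x * y ≉ 0#
    *-≉0 x≉0 y≉0 xy≈0 = x≉0 (zero-product xy≈0 y≉0)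

module Polynomials {ℓ} (R : CommutativeRing 0ℓ ℓ) where

  open CommutativeRing R hiding (zero; isCommutativeRing)
  open ZeroDivisors R using (zero-product)
  import Algebra.Solver.CommutativeMonoid +-commutativeMonoid as +-Solver
  open import Algebra.Properties.Ring ring using (-0#≈0#)
  import Relation.Binary.Reasoning.Setoid as SetoidReasoning
  module ≈-Reasoning = SetoidReasoning setoid
  -- Defs' operations, so that ℚ[T] and ℚ[T,U] below compute exactly like PT and P2.
  open PolyOps 0# _+_ _*_ public

  Poly : Set
  Poly = List Carrier

  infixl 6 _⊕_
  infixl 7 _⊗_ _·_

  _⊕_ _⊗_ : Poly → Poly → Poly
  _⊕_ = addP
  _⊗_ = mulP

  ⊝_ : Poly → Poly
  ⊝_ = List.map (λ a → - a)

  _·_ : Carrier → Poly → Poly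
  a · p = List.map (a *_) p

  𝟙 : Poly
  𝟙 = 1# ∷ []

  coeff : Poly → ℕ → Carrier
  coeff []      i       = 0#
  coeff (a ∷ p) zero    = a
  coeff (a ∷ p) (suc i) = coeff p i

  infix 4 _≋_
  record _≋_ (p q : Poly) : Set ℓ where
    constructor coeffwise
    field at : ∀ i → coeff p i ≈ coeff q i
  open _≋_ public

  ≋-refl : ∀ {p} → p ≋ p
  ≋-refl = coeffwise λ _ → refl

  ≋-sym : ∀ {p q} → p ≋ q → q ≋ p
  ≋-sym p≋q = coeffwise λ i → sym (at p≋q i)

  ≋-trans : ∀ {p q r} → p ≋ q → q ≋ r → p ≋ r
  ≋-trans p≋q q≋r = coeffwise λ i → trans (at p≋q i) (at q≋r i)

  ≋-setoid : Setoid 0ℓ ℓ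
  ≋-setoid = record
    { Carrier = Poly ; _≈_ = _≋_
    ; isEquivalence = record { refl = ≋-refl ; sym = ≋-sym ; trans = ≋-trans } }

  module ≋-Reasoning = SetoidReasoning ≋-setoid

  ∷-cong : ∀ {a b p q} → a ≈ b → p ≋ q → a ∷ p ≋ b ∷ q
  ∷-cong a≈b p≋q = coeffwise λ { zero → a≈b ; (suc i) → at p≋q i }

  ∷≋[]-tail : ∀ {a p} → a ∷ p ≋ [] → p ≋ []
  ∷≋[]-tail e = coeffwise λ i → at e (suc i)

  ∷-injective : ∀ {a b p q} → a ∷ p ≋ b ∷ q → a ≈ b
  ∷-injective e = at e zero

  ∷-tail : ∀ {a b p q} → a ∷ p ≋ b ∷ q → p ≋ q
  ∷-tail e = coeffwise λ i → at e (suc i)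

  0∷[]≋[] : 0# ∷ [] ≋ []
  0∷[]≋[] = coeffwise λ { zero → refl ; (suc i) → refl }

  coeff-⊕ : ∀ p q i → coeff (p ⊕ q) i ≈ coeff p i + coeff q i
  coeff-⊕ []      q       i       = sym (+-identityˡ _)
  coeff-⊕ (a ∷ p) []      i       = sym (+-identityʳ _)
  coeff-⊕ (a ∷ p) (b ∷ q) zero    = refl
  coeff-⊕ (a ∷ p) (b ∷ q) (suc i) = coeff-⊕ p q i

  coeff-⊝ : ∀ p i → coeff (⊝ p) i ≈ - coeff p i
  coeff-⊝ []      i       = sym -0#≈0#
  coeff-⊝ (a ∷ p) zero    = refl
  coeff-⊝ (a ∷ p) (suc i) = coeff-⊝ p i

  coeff-· : ∀ a p i → coeff (a · p) i ≈ a * coeff p i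
  coeff-· a []      i       = sym (zeroʳ a)
  coeff-· a (b ∷ p) zero    = refl
  coeff-· a (b ∷ p) (suc i) = coeff-· a p i

  coeff₀-⊗ : ∀ p q → coeff (p ⊗ q) 0 ≈ coeff p 0 * coeff q 0
  coeff₀-⊗ []      q = sym (zeroˡ _)
  coeff₀-⊗ (a ∷ p) q = trans (coeff-⊕ (a · q) (0# ∷ p ⊗ q) 0) (trans (+-identityʳ _) (coeff-· a q 0))

  ⊕-coeffwise : ∀ p q r s → (∀ i → coeff p i + coeff q i ≈ coeff r i + coeff s i) → p ⊕ q ≋ r ⊕ s
  ⊕-coeffwise p q r s eq = coeffwise λ i →
    trans (coeff-⊕ p q i) (trans (eq i) (sym (coeff-⊕ r s i)))

  ⊕-cong : ∀ {p p′ q q′} → p ≋ p′ → q ≋ q′ → p ⊕ q ≋ p′ ⊕ q′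
  ⊕-cong {p} {p′} {q} {q′} p≋p′ q≋q′ = ⊕-coeffwise p q p′ q′ λ i → +-cong (at p≋p′ i) (at q≋q′ i)

  ⊝-cong : ∀ {p q} → p ≋ q → ⊝ p ≋ ⊝ q
  ⊝-cong {p} {q} p≋q = coeffwise λ i → trans (coeff-⊝ p i) (trans (-‿cong (at p≋q i)) (sym (coeff-⊝ q i)))

  ·-cong : ∀ {a b p q} → a ≈ b → p ≋ q → a · p ≋ b · q
  ·-cong {a} {b} {p} {q} a≈b p≋q = coeffwise λ i →
    trans (coeff-· a p i) (trans (*-cong a≈b (at p≋q i)) (sym (coeff-· b q i)))

  ⊕-assoc : ∀ p q r → (p ⊕ q) ⊕ r ≋ p ⊕ (q ⊕ r)
  ⊕-assoc p q r = ⊕-coeffwise (p ⊕ q) r p (q ⊕ r) λ i → begin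
    coeff (p ⊕ q) i + coeff r i              ≈⟨ +-congʳ (coeff-⊕ p q i) ⟩
    (coeff p i + coeff q i) + coeff r i      ≈⟨ +-assoc _ _ _ ⟩
    coeff p i + (coeff q i + coeff r i)      ≈⟨ +-congˡ (coeff-⊕ q r i) ⟨
    coeff p i + coeff (q ⊕ r) i              ∎
    where
    open ≈-Reasoning

  ⊕-comm : ∀ p q → p ⊕ q ≋ q ⊕ p
  ⊕-comm p q = ⊕-coeffwise p q q p λ i → +-comm _ _

  ⊕-identityʳ : ∀ p → p ⊕ [] ≋ p
  ⊕-identityʳ p = coeffwise λ i → trans (coeff-⊕ p [] i) (+-identityʳ _)

  ⊕-inverseˡ : ∀ p → ⊝ p ⊕ p ≋ []
  ⊕-inverseˡ p = coeffwise λ i →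
    trans (coeff-⊕ (⊝ p) p i) (trans (+-congʳ (coeff-⊝ p i)) (-‿inverseˡ _))

  ⊕-inverseʳ : ∀ p → p ⊕ ⊝ p ≋ []
  ⊕-inverseʳ p = ≋-trans (⊕-comm p (⊝ p)) (⊕-inverseˡ p)

  ⊕-interchange : ∀ p q r s → (p ⊕ q) ⊕ (r ⊕ s) ≋ (p ⊕ r) ⊕ (q ⊕ s)
  ⊕-interchange p q r s = ⊕-coeffwise (p ⊕ q) (r ⊕ s) (p ⊕ r) (q ⊕ s) λ i → begin
    coeff (p ⊕ q) i + coeff (r ⊕ s) i
      ≈⟨ +-cong (coeff-⊕ p q i) (coeff-⊕ r s i) ⟩
    (coeff p i + coeff q i) + (coeff r i + coeff s i)
      ≈⟨ solve 4 (λ a b c d → (a ⊕′ b) ⊕′ (c ⊕′ d) ⊜ (a ⊕′ c) ⊕′ (b ⊕′ d)) refl _ _ _ _ ⟩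
    (coeff p i + coeff r i) + (coeff q i + coeff s i)
      ≈⟨ +-cong (coeff-⊕ p r i) (coeff-⊕ q s i) ⟨
    coeff (p ⊕ r) i + coeff (q ⊕ s) i ∎
    where
    open ≈-Reasoning
    open +-Solver using (solve; _⊜_) renaming (_⊕_ to _⊕′_)

  ·-distribˡ-⊕ : ∀ a p q → a · (p ⊕ q) ≋ a · p ⊕ a · q
  ·-distribˡ-⊕ a p q = coeffwise λ i → begin
    coeff (a · (p ⊕ q)) i                   ≈⟨ coeff-· a (p ⊕ q) i ⟩
    a * coeff (p ⊕ q) i                     ≈⟨ *-congˡ (coeff-⊕ p q i) ⟩
    a * (coeff p i + coeff q i)             ≈⟨ distribˡ _ _ _ ⟩
    a * coeff p i + a * coeff q i           ≈⟨ +-cong (coeff-· a p i) (coeff-· a q i) ⟨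
    coeff (a · p) i + coeff (a · q) i       ≈⟨ coeff-⊕ (a · p) (a · q) i ⟨
    coeff (a · p ⊕ a · q) i                 ∎
    where
    open ≈-Reasoning

  ·-distribʳ-+ : ∀ a b p → (a + b) · p ≋ a · p ⊕ b · p
  ·-distribʳ-+ a b p = coeffwise λ i → begin
    coeff ((a + b) · p) i                   ≈⟨ coeff-· (a + b) p i ⟩
    (a + b) * coeff p i                     ≈⟨ distribʳ _ _ _ ⟩
    a * coeff p i + b * coeff p i           ≈⟨ +-cong (coeff-· a p i) (coeff-· b p i) ⟨
    coeff (a · p) i + coeff (b · p) i       ≈⟨ coeff-⊕ (a · p) (b · p) i ⟨
    coeff (a · p ⊕ b · p) i                 ∎
    where
    open ≈-Reasoning

  ·-assoc : ∀ a b p → a · (b · p) ≋ (a * b) · p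
  ·-assoc a b p = coeffwise λ i →
    trans (coeff-· a (b · p) i) (trans (*-congˡ (coeff-· b p i)) (trans (sym (*-assoc _ _ _)) (sym (coeff-· (a * b) p i))))

  ≈0⇒·≋[] : ∀ {a} → a ≈ 0# → ∀ p → a · p ≋ []
  ≈0⇒·≋[] {a} a≈0 p = coeffwise λ i → trans (coeff-· a p i) (trans (*-congʳ a≈0) (zeroˡ _))

  ≋[]⇒⊗≋[] : ∀ {p} → p ≋ [] → ∀ q → p ⊗ q ≋ []
  ≋[]⇒⊗≋[] {[]}    p≋[] q = ≋-refl
  ≋[]⇒⊗≋[] {a ∷ p} p≋[] q =
    ≋-trans (⊕-cong {a · q} {[]} (≈0⇒·≋[] (at p≋[] 0) q) (∷-cong refl (≋[]⇒⊗≋[] (∷≋[]-tail p≋[]) q))) 0∷[]≋[]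

  ⊗-congˡ : ∀ {p p′} → p ≋ p′ → ∀ q → p ⊗ q ≋ p′ ⊗ q
  ⊗-congˡ {[]}    {p′}     p≋p′ q = ≋-sym (≋[]⇒⊗≋[] (≋-sym p≋p′) q)
  ⊗-congˡ {a ∷ p} {[]}     p≋p′ q = ≋[]⇒⊗≋[] p≋p′ q
  ⊗-congˡ {a ∷ p} {a′ ∷ p′} p≋p′ q =
    ⊕-cong (·-cong (∷-injective p≋p′) ≋-refl) (∷-cong refl (⊗-congˡ (∷-tail p≋p′) q))

  ⊗-zeroʳ : ∀ p → p ⊗ [] ≋ []
  ⊗-zeroʳ []      = ≋-refl
  ⊗-zeroʳ (a ∷ p) = ≋-trans (∷-cong refl (⊗-zeroʳ p)) 0∷[]≋[]

  ⊗-∷ʳ : ∀ p b q → p ⊗ (b ∷ q) ≋ b · p ⊕ (0# ∷ p ⊗ q)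
  ⊗-∷ʳ []      b q = ≋-sym 0∷[]≋[]
  ⊗-∷ʳ (a ∷ p) b q = ∷-cong (trans (+-identityʳ _) (trans (*-comm a b) (sym (+-identityʳ _))))
    (begin
      a · q ⊕ p ⊗ (b ∷ q)           ≈⟨ ⊕-cong (≋-refl {a · q}) (⊗-∷ʳ p b q) ⟩
      a · q ⊕ (b · p ⊕ (0# ∷ p ⊗ q)) ≈⟨ ⊕-assoc (a · q) (b · p) _ ⟨
      (a · q ⊕ b · p) ⊕ (0# ∷ p ⊗ q) ≈⟨ ⊕-cong (⊕-comm (a · q) (b · p)) ≋-refl ⟩
      (b · p ⊕ a · q) ⊕ (0# ∷ p ⊗ q) ≈⟨ ⊕-assoc (b · p) (a · q) _ ⟩
      b · p ⊕ (a · q ⊕ (0# ∷ p ⊗ q)) ∎)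
    where
    open ≋-Reasoning

  ⊗-comm : ∀ p q → p ⊗ q ≋ q ⊗ p
  ⊗-comm []      q = ≋-sym (⊗-zeroʳ q)
  ⊗-comm (a ∷ p) q = ≋-trans (⊕-cong ≋-refl (∷-cong refl (⊗-comm p q))) (≋-sym (⊗-∷ʳ q a p))

  ⊗-cong : ∀ {p p′ q q′} → p ≋ p′ → q ≋ q′ → p ⊗ q ≋ p′ ⊗ q′
  ⊗-cong {p} {p′} {q} {q′} p≋p′ q≋q′ = begin
    p ⊗ q     ≈⟨ ⊗-congˡ p≋p′ q ⟩
    p′ ⊗ q    ≈⟨ ⊗-comm p′ q ⟩
    q ⊗ p′    ≈⟨ ⊗-congˡ q≋q′ p′ ⟩
    q′ ⊗ p′   ≈⟨ ⊗-comm q′ p′ ⟩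
    p′ ⊗ q′   ∎
    where
    open ≋-Reasoning

  ⊗-distribʳ : ∀ p q r → (p ⊕ q) ⊗ r ≋ p ⊗ r ⊕ q ⊗ r
  ⊗-distribʳ []      q       r = ≋-refl
  ⊗-distribʳ (a ∷ p) []      r = ≋-sym (⊕-identityʳ _)
  ⊗-distribʳ (a ∷ p) (b ∷ q) r =
    ≋-trans (⊕-cong (·-distribʳ-+ a b r) (∷-cong (sym (+-identityʳ 0#)) (⊗-distribʳ p q r)))
            (⊕-interchange (a · r) (b · r) _ _)

  ⊗-distribˡ : ∀ p q r → p ⊗ (q ⊕ r) ≋ p ⊗ q ⊕ p ⊗ r
  ⊗-distribˡ p q r = begin
    p ⊗ (q ⊕ r)       ≈⟨ ⊗-comm p (q ⊕ r) ⟩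
    (q ⊕ r) ⊗ p       ≈⟨ ⊗-distribʳ q r p ⟩
    q ⊗ p ⊕ r ⊗ p     ≈⟨ ⊕-cong (⊗-comm q p) (⊗-comm r p) ⟩
    p ⊗ q ⊕ p ⊗ r     ∎
    where
    open ≋-Reasoning

  ·-⊗ : ∀ a p q → a · p ⊗ q ≋ a · (p ⊗ q)
  ·-⊗ a []      q = ≋-refl
  ·-⊗ a (b ∷ p) q =
    ≋-trans (⊕-cong (≋-sym (·-assoc a b q)) (∷-cong (sym (zeroʳ a)) (·-⊗ a p q)))
            (≋-sym (·-distribˡ-⊕ a (b · q) (0# ∷ p ⊗ q)))

  0∷-⊗ : ∀ p q → (0# ∷ p) ⊗ q ≋ 0# ∷ p ⊗ q
  0∷-⊗ p q = ⊕-cong {0# · q} {[]} (≈0⇒·≋[] refl q) ≋-refl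

  ⊗-assoc : ∀ p q r → (p ⊗ q) ⊗ r ≋ p ⊗ (q ⊗ r)
  ⊗-assoc []      q r = ≋-refl
  ⊗-assoc (a ∷ p) q r =
    ≋-trans (⊗-distribʳ (a · q) _ r)
            (⊕-cong (·-⊗ a q r) (≋-trans (0∷-⊗ (p ⊗ q) r) (∷-cong refl (⊗-assoc p q r))))

  ⊗-identityˡ : ∀ p → 𝟙 ⊗ p ≋ p
  ⊗-identityˡ p = coeffwise λ i → begin
    coeff (1# · p ⊕ (0# ∷ [])) i          ≈⟨ coeff-⊕ (1# · p) _ i ⟩
    coeff (1# · p) i + coeff (0# ∷ []) i  ≈⟨ +-cong (coeff-· 1# p i) (at 0∷[]≋[] i) ⟩
    1# * coeff p i + 0#                   ≈⟨ +-identityʳ _ ⟩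
    1# * coeff p i                        ≈⟨ *-identityˡ _ ⟩
    coeff p i                             ∎
    where
    open ≈-Reasoning

  isCommutativeRing : IsCommutativeRing _≋_ _⊕_ _⊗_ ⊝_ [] 𝟙
  isCommutativeRing = record
    { isRing = record
      { +-isAbelianGroup = record
        { isGroup = record
          { isMonoid = record
            { isSemigroup = record
              { isMagma = record
                { isEquivalence = Setoid.isEquivalence ≋-setoid
                ; ∙-cong = ⊕-cong }
              ; assoc = ⊕-assoc }
            ; identity = (λ _ → ≋-refl) , ⊕-identityʳ }
          ; inverse = ⊕-inverseˡ , ⊕-inverseʳ
          ; ⁻¹-cong = ⊝-cong }
        ; comm = ⊕-comm }
      ; *-cong = ⊗-cong
      ; *-assoc = ⊗-assoc
      ; *-identity = ⊗-identityˡ , (λ p → ≋-trans (⊗-comm p 𝟙) (⊗-identityˡ p))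
      ; distrib = ⊗-distribˡ , (λ r p q → ⊗-distribʳ p q r) }
    ; *-comm = ⊗-comm }

  commutativeRing : CommutativeRing 0ℓ ℓ
  commutativeRing = record { isCommutativeRing = isCommutativeRing }

  ≋[]⇒All≈0 : ∀ {p} → p ≋ [] → All (_≈ 0#) p
  ≋[]⇒All≈0 {[]}    p≋[] = []
  ≋[]⇒All≈0 {a ∷ p} p≋[] = at p≋[] 0 ∷ ≋[]⇒All≈0 (∷≋[]-tail p≋[])

  All≈0⇒≋[] : ∀ {p} → All (_≈ 0#) p → p ≋ []
  All≈0⇒≋[] []           = ≋-refl
  All≈0⇒≋[] (a≈0 ∷ p≈0) = ≋-trans (∷-cong a≈0 (All≈0⇒≋[] p≈0)) 0∷[]≋[]

  ≋[]? : (∀ a → Dec (a ≈ 0#)) → ∀ p → Dec (p ≋ [])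
  ≋[]? ≈0? p = map′ All≈0⇒≋[] ≋[]⇒All≈0 (all? ≈0? p)

  module _ (≈0? : ∀ a → Dec (a ≈ 0#)) (cancel : AlmostRightCancellative _≈_ 0# _*_) where

    private
      ⊗-∷-zero-product : ∀ {b} q p → b ≉ 0# → p ⊗ (b ∷ q) ≋ [] → p ≋ []
      ⊗-∷-zero-product q []      b≉0 _ = ≋-refl
      ⊗-∷-zero-product {b} q (a ∷ p) b≉0 ap⊗bq≋[] =
        ≋-trans (∷-cong a≈0 (⊗-∷-zero-product q p b≉0 (∷≋[]-tail 0∷p⊗bq≋[]))) 0∷[]≋[]
        where
        a≈0 : a ≈ 0#
        a≈0 = zero-product cancel (trans (sym (+-identityʳ _)) (at ap⊗bq≋[] 0)) b≉0
        0∷p⊗bq≋[] : 0# ∷ p ⊗ (b ∷ q) ≋ []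
        0∷p⊗bq≋[] = ≋-trans (≋-sym (⊕-cong {a · (b ∷ q)} {[]} (≈0⇒·≋[] a≈0 (b ∷ q)) ≋-refl)) ap⊗bq≋[]

    ⊗-zero-product : ∀ p q → p ⊗ q ≋ [] → ¬ q ≋ [] → p ≋ []
    ⊗-zero-product p []      _      q≉[] = contradiction ≋-refl q≉[]
    ⊗-zero-product p (b ∷ q) p⊗q≋[] q≉[] with ≈0? b
    ... | no  b≉0 = ⊗-∷-zero-product q p b≉0 p⊗q≋[]
    ... | yes b≈0 = ⊗-zero-product p q (∷≋[]-tail 0∷p⊗q≋[]) (λ q≋[] → q≉[] (All≈0⇒≋[] (b≈0 ∷ ≋[]⇒All≈0 q≋[])))
      where
      0∷p⊗q≋[] : 0# ∷ p ⊗ q ≋ []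
      0∷p⊗q≋[] = ≋-trans (≋-sym (⊕-cong {b · p} {[]} (≈0⇒·≋[] b≈0 p) ≋-refl))
                         (≋-trans (≋-sym (⊗-∷ʳ p b q)) p⊗q≋[])

    ⊗-almostCancelʳ : AlmostRightCancellative _≋_ [] _⊗_
    ⊗-almostCancelʳ = ZeroDivisors.zero-product⇒almostCancelʳ commutativeRing (⊗-zero-product _ _)

module FieldOfFractions {c ℓ} (R : CommutativeRing c ℓ)
  (1≉0 : CommutativeRing._≉_ R (CommutativeRing.1# R) (CommutativeRing.0# R))
  (cancel : AlmostRightCancellative (CommutativeRing._≈_ R) (CommutativeRing.0# R) (CommutativeRing._*_ R)) where

  open CommutativeRing R hiding (isCommutativeRing)

  open IntegerCoefficients R using (solve; _:=_; _:+_; _:*_; _:-_; :-_; con)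
  open ZeroDivisors R using (*-≉0)
  open import Relation.Binary.Reasoning.Setoid setoid

  record Fraction : Set (c ⊔ ℓ) where
    constructor fraction
    field
      numer denom : Carrier
      denom≉0     : denom ≉ 0#
  open Fraction public

  infix 4 _≃_
  record _≃_ (x y : Fraction) : Set ℓ where
    constructor cross
    field uncross : numer x * denom y ≈ numer y * denom x
  open _≃_ public

  infixl 6 _+ᶠ_ _-ᶠ_
  infixl 7 _*ᶠ_
  infix  8 -ᶠ_

  -- _-ᶠ_ is primitive rather than x +ᶠ -ᶠ y so that it agrees with _-C_ definitionally.
  _+ᶠ_ _-ᶠ_ _*ᶠ_ : Fraction → Fraction → Fraction
  x +ᶠ y = fraction (numer x * denom y + numer y * denom x) (denom x * denom y) (*-≉0 cancel (denom≉0 x) (denom≉0 y))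
  x -ᶠ y = fraction (numer x * denom y - numer y * denom x) (denom x * denom y) (*-≉0 cancel (denom≉0 x) (denom≉0 y))
  x *ᶠ y = fraction (numer x * numer y) (denom x * denom y) (*-≉0 cancel (denom≉0 x) (denom≉0 y))

  -ᶠ_ : Fraction → Fraction
  -ᶠ x = fraction (- numer x) (denom x) (denom≉0 x)

  ι : Carrier → Fraction
  ι a = fraction a 1# 1≉0

  0ᶠ 1ᶠ : Fraction
  0ᶠ = ι 0#
  1ᶠ = ι 1#

  ≃-refl : ∀ {x} → x ≃ x
  ≃-refl = cross refl

  ≃-sym : ∀ {x y} → x ≃ y → y ≃ x
  ≃-sym x≃y = cross (sym (uncross x≃y))

  ≃-trans : ∀ {x y z} → x ≃ y → y ≃ z → x ≃ z
  ≃-trans {fraction a b _} {fraction c d d≉0} {fraction e f _} (cross ad≈cb) (cross cf≈ed) =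
    cross (cancel d _ _ d≉0 (begin
      (a * f) * d    ≈⟨ solve 3 (λ a f d → (a :* f) :* d := (a :* d) :* f) refl a f d ⟩
      (a * d) * f    ≈⟨ *-congʳ ad≈cb ⟩
      (c * b) * f    ≈⟨ solve 3 (λ c b f → (c :* b) :* f := (c :* f) :* b) refl c b f ⟩
      (c * f) * b    ≈⟨ *-congʳ cf≈ed ⟩
      (e * d) * b    ≈⟨ solve 3 (λ e d b → (e :* d) :* b := (e :* b) :* d) refl e d b ⟩
      (e * b) * d    ∎))

  +ᶠ-cong : ∀ {x x′ y y′} → x ≃ x′ → y ≃ y′ → x +ᶠ y ≃ x′ +ᶠ y′
  +ᶠ-cong {fraction a b _} {fraction a′ b′ _} {fraction c d _} {fraction c′ d′ _} (cross ab′≈a′b) (cross cd′≈c′d) =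
    cross (begin
      (a * d + c * b) * (b′ * d′)
        ≈⟨ solve 6 (λ a b c d b′ d′ →
             (a :* d :+ c :* b) :* (b′ :* d′) := (a :* b′) :* (d :* d′) :+ (c :* d′) :* (b :* b′)) refl a b c d b′ d′ ⟩
      (a * b′) * (d * d′) + (c * d′) * (b * b′)
        ≈⟨ +-cong (*-congʳ ab′≈a′b) (*-congʳ cd′≈c′d) ⟩
      (a′ * b) * (d * d′) + (c′ * d) * (b * b′)
        ≈⟨ solve 6 (λ a′ b c′ d b′ d′ →
             (a′ :* b) :* (d :* d′) :+ (c′ :* d) :* (b :* b′) := (a′ :* d′ :+ c′ :* b′) :* (b :* d)) refl a′ b c′ d b′ d′ ⟩
      (a′ * d′ + c′ * b′) * (b * d) ∎)

  *ᶠ-cong : ∀ {x x′ y y′} → x ≃ x′ → y ≃ y′ → x *ᶠ y ≃ x′ *ᶠ y′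
  *ᶠ-cong {fraction a b _} {fraction a′ b′ _} {fraction c d _} {fraction c′ d′ _} (cross ab′≈a′b) (cross cd′≈c′d) =
    cross (begin
      (a * c) * (b′ * d′)    ≈⟨ solve 6 (λ a b c d b′ d′ → (a :* c) :* (b′ :* d′) := (a :* b′) :* (c :* d′)) refl a b c d b′ d′ ⟩
      (a * b′) * (c * d′)    ≈⟨ *-cong ab′≈a′b cd′≈c′d ⟩
      (a′ * b) * (c′ * d)    ≈⟨ solve 6 (λ a′ b c′ d b′ d′ → (a′ :* b) :* (c′ :* d) := (a′ :* c′) :* (b :* d)) refl a′ b c′ d b′ d′ ⟩
      (a′ * c′) * (b * d)    ∎)

  -ᶠ-cong : ∀ {x y} → x ≃ y → -ᶠ x ≃ -ᶠ y
  -ᶠ-cong {fraction a b _} {fraction a′ b′ _} (cross ab′≈a′b) = cross (begin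
    - a * b′       ≈⟨ solve 2 (λ a b′ → :- a :* b′ := :- (a :* b′)) refl a b′ ⟩
    - (a * b′)     ≈⟨ -‿cong ab′≈a′b ⟩
    - (a′ * b)     ≈⟨ solve 2 (λ a′ b → :- (a′ :* b) := :- a′ :* b) refl a′ b ⟩
    - a′ * b       ∎)

  +ᶠ-assoc : ∀ x y z → (x +ᶠ y) +ᶠ z ≃ x +ᶠ (y +ᶠ z)
  +ᶠ-assoc (fraction a b _) (fraction c d _) (fraction e f _) = cross (solve 6 (λ a b c d e f →
    ((a :* d :+ c :* b) :* f :+ e :* (b :* d)) :* (b :* (d :* f)) := (a :* (d :* f) :+ (c :* f :+ e :* d) :* b) :* ((b :* d) :* f))
    refl a b c d e f)

  +ᶠ-comm : ∀ x y → x +ᶠ y ≃ y +ᶠ x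
  +ᶠ-comm (fraction a b _) (fraction c d _) = cross (solve 4 (λ a b c d →
    (a :* d :+ c :* b) :* (d :* b) := (c :* b :+ a :* d) :* (b :* d)) refl a b c d)

  +ᶠ-identityˡ : ∀ x → 0ᶠ +ᶠ x ≃ x
  +ᶠ-identityˡ (fraction a b _) = cross (solve 2 (λ a b → (con (+ 0) :* b :+ a :* con (+ 1)) :* b := a :* (con (+ 1) :* b)) refl a b)

  +ᶠ-identityʳ : ∀ x → x +ᶠ 0ᶠ ≃ x
  +ᶠ-identityʳ x = ≃-trans (+ᶠ-comm x 0ᶠ) (+ᶠ-identityˡ x)

  -ᶠ‿inverseˡ : ∀ x → -ᶠ x +ᶠ x ≃ 0ᶠ
  -ᶠ‿inverseˡ (fraction a b _) = cross (solve 2 (λ a b → (:- a :* b :+ a :* b) :* con (+ 1) := con (+ 0) :* (b :* b)) refl a b)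

  -ᶠ‿inverseʳ : ∀ x → x +ᶠ -ᶠ x ≃ 0ᶠ
  -ᶠ‿inverseʳ x = ≃-trans (+ᶠ-comm x (-ᶠ x)) (-ᶠ‿inverseˡ x)

  *ᶠ-assoc : ∀ x y z → (x *ᶠ y) *ᶠ z ≃ x *ᶠ (y *ᶠ z)
  *ᶠ-assoc (fraction a b _) (fraction c d _) (fraction e f _) = cross (solve 6 (λ a b c d e f →
    ((a :* c) :* e) :* (b :* (d :* f)) := (a :* (c :* e)) :* ((b :* d) :* f)) refl a b c d e f)

  *ᶠ-comm : ∀ x y → x *ᶠ y ≃ y *ᶠ x
  *ᶠ-comm (fraction a b _) (fraction c d _) = cross (solve 4 (λ a b c d →
    (a :* c) :* (d :* b) := (c :* a) :* (b :* d)) refl a b c d)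

  *ᶠ-identityˡ : ∀ x → 1ᶠ *ᶠ x ≃ x
  *ᶠ-identityˡ (fraction a b _) = cross (solve 2 (λ a b → (con (+ 1) :* a) :* b := a :* (con (+ 1) :* b)) refl a b)

  *ᶠ-identityʳ : ∀ x → x *ᶠ 1ᶠ ≃ x
  *ᶠ-identityʳ x = ≃-trans (*ᶠ-comm x 1ᶠ) (*ᶠ-identityˡ x)

  *ᶠ-distribʳ-+ᶠ : ∀ x y z → (y +ᶠ z) *ᶠ x ≃ y *ᶠ x +ᶠ z *ᶠ x
  *ᶠ-distribʳ-+ᶠ (fraction a b _) (fraction c d _) (fraction e f _) = cross (solve 6 (λ a b c d e f →
    ((c :* f :+ e :* d) :* a) :* ((d :* b) :* (f :* b)) := ((c :* a) :* (f :* b) :+ (e :* a) :* (d :* b)) :* ((d :* f) :* b))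
    refl a b c d e f)

  *ᶠ-distribˡ-+ᶠ : ∀ x y z → x *ᶠ (y +ᶠ z) ≃ x *ᶠ y +ᶠ x *ᶠ z
  *ᶠ-distribˡ-+ᶠ x y z = ≃-trans (*ᶠ-comm x (y +ᶠ z))
    (≃-trans (*ᶠ-distribʳ-+ᶠ x y z) (+ᶠ-cong (*ᶠ-comm y x) (*ᶠ-comm z x)))

  isCommutativeRing : IsCommutativeRing _≃_ _+ᶠ_ _*ᶠ_ -ᶠ_ 0ᶠ 1ᶠ
  isCommutativeRing = record
    { isRing = record
      { +-isAbelianGroup = record
        { isGroup = record
          { isMonoid = record
            { isSemigroup = record
              { isMagma = record
                { isEquivalence = record { refl = ≃-refl ; sym = ≃-sym ; trans = ≃-trans }
                ; ∙-cong = +ᶠ-cong }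
              ; assoc = +ᶠ-assoc }
            ; identity = +ᶠ-identityˡ , +ᶠ-identityʳ }
          ; inverse = -ᶠ‿inverseˡ , -ᶠ‿inverseʳ
          ; ⁻¹-cong = -ᶠ-cong }
        ; comm = +ᶠ-comm }
      ; *-cong = *ᶠ-cong
      ; *-assoc = *ᶠ-assoc
      ; *-identity = *ᶠ-identityˡ , *ᶠ-identityʳ
      ; distrib = *ᶠ-distribˡ-+ᶠ , *ᶠ-distribʳ-+ᶠ }
    ; *-comm = *ᶠ-comm }

  commutativeRing : CommutativeRing (c ⊔ ℓ) ℓ
  commutativeRing = record { isCommutativeRing = isCommutativeRing }

  -ᶠ≃+ᶠ-ᶠ : ∀ x y → x -ᶠ y ≃ x +ᶠ -ᶠ y
  -ᶠ≃+ᶠ-ᶠ (fraction a b _) (fraction c d _) = cross (solve 4 (λ a b c d →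
    (a :* d :- c :* b) :* (b :* d) := (a :* d :+ :- c :* b) :* (b :* d)) refl a b c d)

  ι-+ : ∀ a b → ι (a + b) ≃ ι a +ᶠ ι b
  ι-+ a b = cross (solve 2 (λ a b → (a :+ b) :* (con (+ 1) :* con (+ 1)) := (a :* con (+ 1) :+ b :* con (+ 1)) :* con (+ 1)) refl a b)

  ≃0⇒numer≈0 : ∀ {x} → x ≃ 0ᶠ → numer x ≈ 0#
  ≃0⇒numer≈0 {x} (cross x1≈0d) = trans (sym (*-identityʳ _)) (trans x1≈0d (zeroˡ (denom x)))

  numer≈0⇒≃0 : ∀ {x} → numer x ≈ 0# → x ≃ 0ᶠ
  numer≈0⇒≃0 {x} x≈0 = cross (trans (*-identityʳ _) (trans x≈0 (sym (zeroˡ (denom x)))))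

  *ᶠ-almostCancelʳ : AlmostRightCancellative _≃_ 0ᶠ _*ᶠ_
  *ᶠ-almostCancelʳ (fraction c d d≉0) (fraction a b _) (fraction a′ b′ _) c/d≄0 (cross ac·b′d≈a′c·bd) =
    cross (cancel (c * d) _ _ (*-≉0 cancel (λ c≈0 → c/d≄0 (numer≈0⇒≃0 c≈0)) d≉0) (begin
      (a * b′) * (c * d)    ≈⟨ solve 4 (λ a b′ c d → (a :* b′) :* (c :* d) := (a :* c) :* (b′ :* d)) refl a b′ c d ⟩
      (a * c) * (b′ * d)    ≈⟨ ac·b′d≈a′c·bd ⟩
      (a′ * c) * (b * d)    ≈⟨ solve 4 (λ a′ b c d → (a′ :* c) :* (b :* d) := (a′ :* b) :* (c :* d)) refl a′ b c d ⟩
      (a′ * b) * (c * d)    ∎))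

  divide : (x y : Fraction) → numer y ≉ 0# → Fraction
  divide x y y≉0 = fraction (numer x * denom y) (denom x * numer y) (*-≉0 cancel (denom≉0 x) y≉0)

  divide-*ᶠ : ∀ x y (y≉0 : numer y ≉ 0#) → divide x y y≉0 *ᶠ y ≃ x
  divide-*ᶠ (fraction a b _) (fraction c d _) _ = cross (solve 4 (λ a b c d →
    ((a :* d) :* c) :* b := a :* ((b :* c) :* d)) refl a b c d)

module NewtonIteration {c ℓ} (R : CommutativeRing c ℓ) (T U : CommutativeRing.Carrier R) where

  open CommutativeRing R

  open IntegerCoefficients R using (solve; _:=_; _:+_; _:*_; _:-_; :-_; con)
  open import Relation.Binary.Reasoning.Setoid setoid

  NewtonStep : Carrier → Carrier → Set ℓ
  NewtonStep x z = z * (x + x - T) ≈ x * x - U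

  NewtonStep-respˡ : ∀ {x y z} → x ≈ y → NewtonStep x z → NewtonStep y z
  NewtonStep-respˡ {x} {y} {z} x≈y step = begin
    z * (y + y - T)    ≈⟨ *-congˡ (+-congʳ (+-cong x≈y x≈y)) ⟨
    z * (x + x - T)    ≈⟨ step ⟩
    x * x - U          ≈⟨ +-congʳ (*-cong x≈y x≈y) ⟩
    y * y - U          ∎

  -- In a field: s² - T s + U = V / P² and 2 s - T = - h / P.
  record Approximant (s P h V : Carrier) : Set ℓ where
    field
      residual : (s * s - T * s + U) * P * P ≈ V
      slope    : (s + s - T) * P ≈ - h

  Approximant-resp : ∀ {s P h V s′ P′ h′ V′} → s ≈ s′ → P ≈ P′ → h ≈ h′ → V ≈ V′ →
                     Approximant s P h V → Approximant s′ P′ h′ V′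
  Approximant-resp s≈s′ P≈P′ h≈h′ V≈V′ a = record
    { residual = trans (sym (*-cong (*-cong (+-cong (+-cong (*-cong s≈s′ s≈s′) (-‿cong (*-congˡ s≈s′))) refl) P≈P′) P≈P′))
                       (trans residual V≈V′)
    ; slope    = trans (sym (*-cong (+-congʳ (+-cong s≈s′ s≈s′)) P≈P′)) (trans slope (-‿cong h≈h′))
    }
    where
    open Approximant a

  approximant-initial : Approximant 0# 1# T U
  approximant-initial = record
    { residual = solve 2 (λ T U → (con (+ 0) :* con (+ 0) :- T :* con (+ 0) :+ U) :* con (+ 1) :* con (+ 1) := U) refl T U
    ; slope    = solve 1 (λ T → (con (+ 0) :+ con (+ 0) :- T) :* con (+ 1) := :- T) refl T
    }

  module _ {s P h V t : Carrier} (a : Approximant s P h V) (t-def : t * (P * h) ≈ V) where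

    open Approximant a

    approximant-step : Approximant (s + t) (P * h) (h * h - (V + V)) (V * V)
    approximant-step = record
      { residual = begin
          ((s + t) * (s + t) - T * (s + t) + U) * (P * h) * (P * h)
            ≈⟨ solve 6 (λ s t T U P h →
                 ((s :+ t) :* (s :+ t) :- T :* (s :+ t) :+ U) :* (P :* h) :* (P :* h)
                 := ((s :* s :- T :* s :+ U) :* P :* P) :* (h :* h)
                    :+ (t :* (P :* h)) :* ((s :+ s :- T) :* P :* h :+ t :* (P :* h))) refl s t T U P h ⟩
          ((s * s - T * s + U) * P * P) * (h * h) + (t * (P * h)) * ((s + s - T) * P * h + t * (P * h))
            ≈⟨ +-cong (*-congʳ residual) (*-cong t-def (+-cong (*-congʳ slope) t-def)) ⟩
          V * (h * h) + V * (- h * h + V)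
            ≈⟨ solve 2 (λ h V → V :* (h :* h) :+ V :* (:- h :* h :+ V) := V :* V) refl h V ⟩
          V * V ∎
      ; slope = begin
          ((s + t) + (s + t) - T) * (P * h)
            ≈⟨ solve 5 (λ s t T P h →
                 ((s :+ t) :+ (s :+ t) :- T) :* (P :* h) := (s :+ s :- T) :* P :* h :+ (t :* (P :* h) :+ t :* (P :* h)))
                 refl s t T P h ⟩
          (s + s - T) * P * h + (t * (P * h) + t * (P * h))
            ≈⟨ +-cong (*-congʳ slope) (+-cong t-def t-def) ⟩
          - h * h + (V + V)
            ≈⟨ solve 2 (λ h V → :- h :* h :+ (V :+ V) := :- (h :* h :- (V :+ V))) refl h V ⟩
          - (h * h - (V + V)) ∎
      }

    newton-step-value : ∀ {z} → NewtonStep s z → z * ((s + s - T) * P * P) ≈ (s + t) * ((s + s - T) * P * P)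
    newton-step-value {z} step = begin
      z * ((s + s - T) * P * P)
        ≈⟨ solve 4 (λ z s T P → z :* ((s :+ s :- T) :* P :* P) := z :* (s :+ s :- T) :* (P :* P)) refl z s T P ⟩
      z * (s + s - T) * (P * P)
        ≈⟨ *-congʳ step ⟩
      (s * s - U) * (P * P)
        ≈⟨ solve 4 (λ s U P V → (s :* s :- U) :* (P :* P) := (s :* s :- U) :* (P :* P) :+ (V :- V)) refl s U P V ⟩
      (s * s - U) * (P * P) + (V - V)
        ≈⟨ +-congˡ (+-congˡ (-‿cong t-def)) ⟨
      (s * s - U) * (P * P) + (V - t * (P * h))
        ≈⟨ solve 6 (λ s t U P h V →
             (s :* s :- U) :* (P :* P) :+ (V :- t :* (P :* h))
             := V :+ (s :* s :- U) :* (P :* P) :+ t :* (:- h :* P)) refl s t U P h V ⟩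
      V + (s * s - U) * (P * P) + t * (- h * P)
        ≈⟨ +-cong (+-congʳ residual) (*-congˡ (*-congʳ slope)) ⟨
      (s * s - T * s + U) * P * P + (s * s - U) * (P * P) + t * ((s + s - T) * P * P)
        ≈⟨ solve 5 (λ s t T U P →
             (s :* s :- T :* s :+ U) :* P :* P :+ (s :* s :- U) :* (P :* P) :+ t :* ((s :+ s :- T) :* P :* P)
             := (s :+ t) :* ((s :+ s :- T) :* P :* P)) refl s t T U P ⟩
      (s + t) * ((s + s - T) * P * P) ∎

  reflect-denominator : ∀ {x y} → y ≈ T - x → y + y - T ≈ - (x + x - T)
  reflect-denominator {x} {y} y≈T-x = begin
    y + y - T                  ≈⟨ +-congʳ (+-cong y≈T-x y≈T-x) ⟩
    (T - x) + (T - x) - T      ≈⟨ solve 2 (λ x T → (T :- x) :+ (T :- x) :- T := :- (x :+ x :- T)) refl x T ⟩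
    - (x + x - T)              ∎

  newton-step-reflect : ∀ {x y z w} → y ≈ T - x → NewtonStep x z → NewtonStep y w →
                        w * (x + x - T) ≈ (T - z) * (x + x - T)
  newton-step-reflect {x} {y} {z} {w} y≈T-x step-x step-y = begin
    w * (x + x - T)                  ≈⟨ solve 3 (λ w x T → w :* (x :+ x :- T) := :- (w :* :- (x :+ x :- T))) refl w x T ⟩
    - (w * - (x + x - T))            ≈⟨ -‿cong (*-congˡ (reflect-denominator y≈T-x)) ⟨
    - (w * (y + y - T))              ≈⟨ -‿cong step-y ⟩
    - (y * y - U)                    ≈⟨ -‿cong (+-congʳ (*-cong y≈T-x y≈T-x)) ⟩
    - ((T - x) * (T - x) - U)        ≈⟨ solve 3 (λ x T U → :- ((T :- x) :* (T :- x) :- U) := T :* (x :+ x :- T) :- (x :* x :- U)) refl x T U ⟩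
    T * (x + x - T) - (x * x - U)    ≈⟨ +-congˡ (-‿cong step-x) ⟨
    T * (x + x - T) - z * (x + x - T) ≈⟨ solve 3 (λ x z T → T :* (x :+ x :- T) :- z :* (x :+ x :- T) := (T :- z) :* (x :+ x :- T)) refl x z T ⟩
    (T - z) * (x + x - T)            ∎

ℚ-almostCancelʳ : AlmostRightCancellative _≡_ 0ℚ ℚ._*_
ℚ-almostCancelʳ x y z x≢0 yx≡zx = begin
  y                      ≡⟨ ℚ.*-identityʳ y ⟨
  y ℚ.* 1ℚ               ≡⟨ ≡.cong (y ℚ.*_) (ℚ.*-inverseʳ x) ⟨
  y ℚ.* (x ℚ.* 1/ x)     ≡⟨ ℚ.*-assoc y x (1/ x) ⟨
  y ℚ.* x ℚ.* 1/ x       ≡⟨ ≡.cong (ℚ._* 1/ x) yx≡zx ⟩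
  z ℚ.* x ℚ.* 1/ x       ≡⟨ ℚ.*-assoc z x (1/ x) ⟩
  z ℚ.* (x ℚ.* 1/ x)     ≡⟨ ≡.cong (z ℚ.*_) (ℚ.*-inverseʳ x) ⟩
  z ℚ.* 1ℚ               ≡⟨ ℚ.*-identityʳ z ⟩
  z                      ∎
  where
  open ≡.≡-Reasoning
  instance _ = ≢-nonZero x≢0

module ℚ[T] = Polynomials ℚ.+-*-commutativeRing
module ℚ[T,U] = Polynomials ℚ[T].commutativeRing

ℚ[T]-almostCancelʳ : AlmostRightCancellative ℚ[T]._≋_ [] ℚ[T]._⊗_
ℚ[T]-almostCancelʳ = ℚ[T].⊗-almostCancelʳ (ℚ._≟ 0ℚ) ℚ-almostCancelʳ

ℚ[T,U]-almostCancelʳ : AlmostRightCancellative ℚ[T,U]._≋_ [] ℚ[T,U]._⊗_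
ℚ[T,U]-almostCancelʳ = ℚ[T,U].⊗-almostCancelʳ (ℚ[T].≋[]? (ℚ._≟ 0ℚ)) ℚ[T]-almostCancelʳ

ℚ[T,U]-1≉0 : ¬ ℚ[T,U].𝟙 ℚ[T,U].≋ []
ℚ[T,U]-1≉0 1≋0 with ℚ[T].at (ℚ[T,U].at 1≋0 0) 0
... | ()

module ℚ⟨T,U⟩ = FieldOfFractions ℚ[T,U].commutativeRing ℚ[T,U]-1≉0 ℚ[T,U]-almostCancelʳ

open ℚ⟨T,U⟩
  using (Fraction; numer; denom; ι; uncross; _-ᶠ_; -ᶠ≃+ᶠ-ᶠ; ι-+; numer≈0⇒≃0; ≃0⇒numer≈0;
         *ᶠ-almostCancelʳ; divide; divide-*ᶠ)
open CommutativeRing ℚ⟨T,U⟩.commutativeRing hiding (zero)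
open import Algebra.Properties.Semiring.Exp semiring using (_^_; ^-homo-*; ^-congʳ)

⌊_⌋ : Fraction → C
⌊ x ⌋ = numer x ⁄ denom x

≋[]⇒IsZeroP : ∀ {p} → p ℚ[T,U].≋ [] → IsZeroP p
≋[]⇒IsZeroP p≋[] = All.map ℚ[T].≋[]⇒All≈0 (ℚ[T,U].≋[]⇒All≈0 p≋[])

IsZeroP⇒≋[] : ∀ {p} → IsZeroP p → p ℚ[T,U].≋ []
IsZeroP⇒≋[] p≈0 = ℚ[T,U].All≈0⇒≋[] (All.map ℚ[T].All≈0⇒≋[] p≈0)

≈⇒≈C : ∀ {x y} → x ≈ y → ⌊ x ⌋ ≈C ⌊ y ⌋
≈⇒≈C x≈y = ≋[]⇒IsZeroP (x≈y⇒x∙y⁻¹≈ε (uncross x≈y))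
  where
  open import Algebra.Properties.Ring (CommutativeRing.ring ℚ[T,U].commutativeRing) using (x≈y⇒x∙y⁻¹≈ε)

/C-nonzero : ∀ x y → ¬ IsZeroP (num y) → x /C y ≡ just ((num x *P den y) ⁄ (den x *P num y))
/C-nonzero x y y≉0 with isZeroP? (num y)
... | yes y≈0 = contradiction y≈0 y≉0
... | no  _   = ≡.refl

Quotient : Fraction → Fraction → Set
Quotient x y = Σ[ q ∈ Fraction ] ⌊ x ⌋ /C ⌊ y ⌋ ≡ just ⌊ q ⌋ × q * y ≈ x

divide-exactly : ∀ x y → y ≉ 0# → Quotient x y
divide-exactly x y y≉0 =
  divide x y numer≉0 , /C-nonzero ⌊ x ⌋ ⌊ y ⌋ (λ y≈0 → numer≉0 (IsZeroP⇒≋[] y≈0)) , divide-*ᶠ x y numer≉0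
  where
  numer≉0 : ¬ numer y ℚ[T,U].≋ []
  numer≉0 numer≈0 = y≉0 (numer≈0⇒≃0 numer≈0)

-- Chosen so that ⌊ T ⌋, ⌊ U ⌋ and ⌊ 2ᶠ ⌋ reduce to Tc, Uc and 2C.
T U 2ᶠ : Fraction
T  = ι (num Tc)
U  = ι (num Uc)
2ᶠ = ι (ℚ[T,U].𝟙 ℚ[T,U].⊕ ℚ[T,U].𝟙)

2ᶠ*x≈x+x : ∀ x → 2ᶠ * x ≈ x + x
2ᶠ*x≈x+x x = begin
  2ᶠ * x             ≈⟨ *-cong (ι-+ ℚ[T,U].𝟙 ℚ[T,U].𝟙) (refl {x}) ⟩
  (1# + 1#) * x      ≈⟨ distribʳ x 1# 1# ⟩
  1# * x + 1# * x    ≈⟨ +-cong (*-identityˡ x) (*-identityˡ x) ⟩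
  x + x              ∎
  where
  open import Relation.Binary.Reasoning.Setoid setoid

hᶠ : ℕ → Fraction
hᶠ zero    = T
hᶠ (suc n) = hᶠ n * hᶠ n -ᶠ 2ᶠ * U ^ (2 ℕ.^ n)

hprodᶠ : ℕ → Fraction
hprodᶠ zero    = hᶠ zero
hprodᶠ (suc m) = hprodᶠ m * hᶠ (suc m)

⌊U^⌋ : ∀ k → ⌊ U ^ k ⌋ ≡ Uc ^C k
⌊U^⌋ zero    = ≡.refl
⌊U^⌋ (suc k) = ≡.cong (Uc *C_) (⌊U^⌋ k)

⌊hᶠ⌋ : ∀ n → ⌊ hᶠ n ⌋ ≡ h n
⌊hᶠ⌋ zero    = ≡.refl
⌊hᶠ⌋ (suc n) = ≡.cong₂ (λ a b → (a *C a) -C (2C *C b)) (⌊hᶠ⌋ n) (⌊U^⌋ (2 ℕ.^ n))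

⌊hprodᶠ⌋ : ∀ n → ⌊ hprodᶠ n ⌋ ≡ hprod n
⌊hprodᶠ⌋ zero    = ≡.refl
⌊hprodᶠ⌋ (suc n) = ≡.cong₂ _*C_ (⌊hprodᶠ⌋ n) (⌊hᶠ⌋ (suc n))

U⁰-coeff : ℚ[T,U].Poly → ℚ[T].Poly
U⁰-coeff p = ℚ[T,U].coeff p 0

denom-U^≋𝟙 : ∀ k → denom (U ^ k) ℚ[T,U].≋ ℚ[T,U].𝟙
denom-U^≋𝟙 zero    = ℚ[T,U].≋-refl
denom-U^≋𝟙 (suc k) = ℚ[T,U].≋-trans (ℚ[T,U].⊗-identityˡ _) (denom-U^≋𝟙 k)

U⁰-numer-U^ : ∀ k .{{_ : ℕ.NonZero k}} → U⁰-coeff (numer (U ^ k)) ℚ[T].≋ []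
U⁰-numer-U^ (suc k) = ℚ[T,U].coeff₀-⊗ (num Uc) (numer (U ^ k))

U⁰-numer-hᶠ-suc : ∀ n → U⁰-coeff (numer (hᶠ (suc n))) ℚ[T].≋ U⁰-coeff (numer (hᶠ n)) ℚ[T].⊗ U⁰-coeff (numer (hᶠ n))
U⁰-numer-hᶠ-suc n = begin
  U⁰-coeff (A ⊕₂ ⊝₂ B)                       ≈⟨ ℚ[T,U].coeff-⊕ A (⊝₂ B) 0 ⟩
  U⁰-coeff A ⊕ U⁰-coeff (⊝₂ B)               ≈⟨ ⊕-cong leading (≋-trans (ℚ[T,U].coeff-⊝ B 0) (⊝-cong vanishing)) ⟩
  U⁰-coeff g ⊗ U⁰-coeff g ⊕ []               ≈⟨ ⊕-identityʳ (U⁰-coeff g ⊗ U⁰-coeff g) ⟩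
  U⁰-coeff g ⊗ U⁰-coeff g                    ∎
  where
  open ℚ[T]
  open ≋-Reasoning
  open ℚ[T,U] using () renaming (_⊗_ to _⊗₂_; _⊕_ to _⊕₂_; ⊝_ to ⊝₂_; 𝟙 to 𝟙₂)
  g k V W A B : ℚ[T,U].Poly
  g = numer (hᶠ n)
  k = denom (hᶠ n)
  V = numer (U ^ (2 ℕ.^ n))
  W = denom (U ^ (2 ℕ.^ n))
  A = (g ⊗₂ g) ⊗₂ (𝟙₂ ⊗₂ W)
  B = ((𝟙₂ ⊕₂ 𝟙₂) ⊗₂ V) ⊗₂ (k ⊗₂ k)
  c₀-⊗ : ∀ p q → U⁰-coeff (p ⊗₂ q) ≋ U⁰-coeff p ⊗ U⁰-coeff q
  c₀-⊗ = ℚ[T,U].coeff₀-⊗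
  leading : U⁰-coeff A ≋ U⁰-coeff g ⊗ U⁰-coeff g
  leading = begin
    U⁰-coeff ((g ⊗₂ g) ⊗₂ (𝟙₂ ⊗₂ W))            ≈⟨ c₀-⊗ (g ⊗₂ g) (𝟙₂ ⊗₂ W) ⟩
    U⁰-coeff (g ⊗₂ g) ⊗ U⁰-coeff (𝟙₂ ⊗₂ W)     ≈⟨ ⊗-cong (c₀-⊗ g g) (ℚ[T,U].at 𝟙W≋𝟙 0) ⟩
    (U⁰-coeff g ⊗ U⁰-coeff g) ⊗ 𝟙               ≈⟨ ⊗-comm (U⁰-coeff g ⊗ U⁰-coeff g) 𝟙 ⟩
    𝟙 ⊗ (U⁰-coeff g ⊗ U⁰-coeff g)               ≈⟨ ⊗-identityˡ (U⁰-coeff g ⊗ U⁰-coeff g) ⟩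
    U⁰-coeff g ⊗ U⁰-coeff g                     ∎
    where
    𝟙W≋𝟙 : 𝟙₂ ⊗₂ W ℚ[T,U].≋ 𝟙₂
    𝟙W≋𝟙 = ℚ[T,U].≋-trans (ℚ[T,U].⊗-identityˡ W) (denom-U^≋𝟙 (2 ℕ.^ n))
  vanishing : U⁰-coeff B ≋ []
  vanishing = begin
    U⁰-coeff (((𝟙₂ ⊕₂ 𝟙₂) ⊗₂ V) ⊗₂ (k ⊗₂ k))          ≈⟨ c₀-⊗ ((𝟙₂ ⊕₂ 𝟙₂) ⊗₂ V) (k ⊗₂ k) ⟩
    U⁰-coeff ((𝟙₂ ⊕₂ 𝟙₂) ⊗₂ V) ⊗ U⁰-coeff (k ⊗₂ k)    ≈⟨ ⊗-congˡ (c₀-⊗ (𝟙₂ ⊕₂ 𝟙₂) V) (U⁰-coeff (k ⊗₂ k)) ⟩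
    ((𝟙 ⊕ 𝟙) ⊗ U⁰-coeff V) ⊗ U⁰-coeff (k ⊗₂ k)        ≈⟨ ⊗-congˡ 2V≋[] (U⁰-coeff (k ⊗₂ k)) ⟩
    []                                                ∎
    where
    2V≋[] : (𝟙 ⊕ 𝟙) ⊗ U⁰-coeff V ≋ []
    2V≋[] = ≋-trans (⊗-comm (𝟙 ⊕ 𝟙) (U⁰-coeff V)) (⊗-congˡ (U⁰-numer-U^ (2 ℕ.^ n) {{ℕ.m^n≢0 2 n}}) (𝟙 ⊕ 𝟙))

-- Modulo U we have h (n + 1) ≡ h n ², hence h n ≡ T ^ (2 ^ n) ≢ 0.
U⁰-numer-hᶠ≉0 : ∀ n → ¬ U⁰-coeff (numer (hᶠ n)) ℚ[T].≋ []
U⁰-numer-hᶠ≉0 zero    T≋[] with ℚ[T].at T≋[] 1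
... | ()
U⁰-numer-hᶠ≉0 (suc n) hₙ₊₁≋[] = ZeroDivisors.*-≉0 ℚ[T].commutativeRing ℚ[T]-almostCancelʳ
  (U⁰-numer-hᶠ≉0 n) (U⁰-numer-hᶠ≉0 n) (ℚ[T].≋-trans (ℚ[T].≋-sym (U⁰-numer-hᶠ-suc n)) hₙ₊₁≋[])

open ZeroDivisors ℚ⟨T,U⟩.commutativeRing using (*-≉0ˡ; -‿≉0; *-≉0)

hᶠ≉0 : ∀ n → hᶠ n ≉ 0#
hᶠ≉0 n h≈0 = U⁰-numer-hᶠ≉0 n (ℚ[T,U].at (≃0⇒numer≈0 h≈0) 0)

hprodᶠ≉0 : ∀ n → hprodᶠ n ≉ 0#
hprodᶠ≉0 zero    = hᶠ≉0 0
hprodᶠ≉0 (suc n) = *-≉0 *ᶠ-almostCancelʳ (hprodᶠ≉0 n) (hᶠ≉0 (suc n))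

U^2^suc : ∀ n → U ^ (2 ℕ.^ suc n) ≈ U ^ (2 ℕ.^ n) * U ^ (2 ℕ.^ n)
U^2^suc n = trans (^-congʳ U (≡.cong (2 ℕ.^ n ℕ.+_) (ℕ.+-identityʳ (2 ℕ.^ n)))) (^-homo-* U (2 ℕ.^ n) (2 ℕ.^ n))

hᶠ-suc : ∀ n → hᶠ (suc n) ≈ hᶠ n * hᶠ n - (U ^ (2 ℕ.^ n) + U ^ (2 ℕ.^ n))
hᶠ-suc n = trans (-ᶠ≃+ᶠ-ᶠ (hᶠ n * hᶠ n) (2ᶠ * U ^ (2 ℕ.^ n)))
                 (+-cong (refl {hᶠ n * hᶠ n}) (-‿cong (2ᶠ*x≈x+x (U ^ (2 ℕ.^ n)))))

open NewtonIteration ℚ⟨T,U⟩.commutativeRing T U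

NewtonImage : Fraction → Set
NewtonImage x = Σ[ z ∈ Fraction ] F ⌊ x ⌋ ≡ just ⌊ z ⌋ × NewtonStep x z

newton-image : ∀ x → x + x - T ≉ 0# → NewtonImage x
newton-image x x+x-T≉0 =
  let (z , F⌊x⌋≡⌊z⌋ , z*D≈N) = divide-exactly N D D≉0
  in z , F⌊x⌋≡⌊z⌋ , trans (*-cong (refl {z}) (sym D≈x+x-T)) (trans z*D≈N N≈x*x-U)
  where
  N D : Fraction
  N = x * x -ᶠ U
  D = 2ᶠ * x -ᶠ T
  N≈x*x-U : N ≈ x * x - U
  N≈x*x-U = -ᶠ≃+ᶠ-ᶠ (x * x) U
  D≈x+x-T : D ≈ x + x - T
  D≈x+x-T = trans (-ᶠ≃+ᶠ-ᶠ (2ᶠ * x) T) (+-cong (2ᶠ*x≈x+x x) (refl { - T}))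
  D≉0 : D ≉ 0#
  D≉0 D≈0 = x+x-T≉0 (trans (sym D≈x+x-T) D≈0)

Iterates : ℕ → Fraction → Set
Iterates n s = Σ[ x ∈ Fraction ] Σ[ y ∈ Fraction ]
  (Fiter n 0C ≡ just ⌊ x ⌋ × Fiter n Tc ≡ just ⌊ y ⌋) × (x ≈ s × y ≈ T - s)

Iterates-resp : ∀ {n s s′} → s ≈ s′ → Iterates n s → Iterates n s′
Iterates-resp s≈s′ (x , y , iterations , x≈s , y≈T-s) =
  x , y , iterations , trans x≈s s≈s′ , trans y≈T-s (+-cong (refl {T}) (-‿cong s≈s′))

iterates-initial : Iterates 0 0#
iterates-initial = ι (num 0C) , T , (≡.refl , ≡.refl) , numer≈0⇒≃0 [[0]]≋[] , T≈T-0
  where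
  [[0]]≋[] : num 0C ℚ[T,U].≋ []
  [[0]]≋[] = ℚ[T,U].All≈0⇒≋[] (ℚ[T].All≈0⇒≋[] (≡.refl ∷ []) ∷ [])
  T≈T-0 : T ≈ T - 0#
  T≈T-0 = sym (trans (+-cong (refl {T}) -0#≈0#) (+-identityʳ T))
    where
    open import Algebra.Properties.Ring ring using (-0#≈0#)

advance : ∀ {n s P h V t} → Iterates n s → Approximant s P h V → P ≉ 0# → h ≉ 0# → t * (P * h) ≈ V →
          Iterates (suc n) (s + t)
advance {n} {s} {P} {h} {V} {t} (x , y , (Fⁿ⌊0⌋≡⌊x⌋ , Fⁿ⌊T⌋≡⌊y⌋) , x≈s , y≈T-s) a P≉0 h≉0 t-def =
  let (x′ , F⌊x⌋≡⌊x′⌋ , step-x) = newton-image x (λ x+x-T≈0 → E≉0 (trans (sym x+x-T≈E) x+x-T≈0))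
      (y′ , F⌊y⌋≡⌊y′⌋ , step-y) = newton-image y (λ y+y-T≈0 → -‿≉0 E≉0 (trans (sym y+y-T≈-E) y+y-T≈0))
  in x′ , y′
   , (≡.trans (≡.cong (_>>= F) Fⁿ⌊0⌋≡⌊x⌋) F⌊x⌋≡⌊x′⌋ , ≡.trans (≡.cong (_>>= F) Fⁿ⌊T⌋≡⌊y⌋) F⌊y⌋≡⌊y′⌋)
   , x′≈s+t {x′} step-x , y′≈T-[s+t] {x′} {y′} step-x step-y
  where
  open Approximant a
  E : Fraction
  E = s + s - T
  E≉0 : E ≉ 0#
  E≉0 = *-≉0ˡ {E} {P} (λ EP≈0 → -‿≉0 h≉0 (trans (sym slope) EP≈0))
  x+x-T≈E : x + x - T ≈ E
  x+x-T≈E = +-cong (+-cong x≈s x≈s) (refl { - T})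
  y+y-T≈-E : y + y - T ≈ - E
  y+y-T≈-E = reflect-denominator {s} y≈T-s
  x′≈s+t : ∀ {x′} → NewtonStep x x′ → x′ ≈ s + t
  x′≈s+t {x′} step-x = *ᶠ-almostCancelʳ (E * P * P) x′ (s + t)
    (*-≉0 *ᶠ-almostCancelʳ (*-≉0 *ᶠ-almostCancelʳ E≉0 P≉0) P≉0)
    (newton-step-value {t = t} a t-def {x′} (NewtonStep-respˡ {x} {s} {x′} x≈s step-x))
  y′≈T-[s+t] : ∀ {x′ y′} → NewtonStep x x′ → NewtonStep y y′ → y′ ≈ T - (s + t)
  y′≈T-[s+t] {x′} {y′} step-x step-y =
    trans (*ᶠ-almostCancelʳ E y′ (T - x′) E≉0
             (newton-step-reflect {s} {y} {x′} {y′} y≈T-s (NewtonStep-respˡ {x} {s} {x′} x≈s step-x) step-y))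
          (+-cong (refl {T}) (-‿cong (x′≈s+t {x′} step-x)))

Stage : ℕ → Set
Stage n = Σ[ s ∈ Fraction ] S n ≡ just ⌊ s ⌋ × Iterates (suc n) s
                          × Approximant s (hprodᶠ n) (hᶠ (suc n)) (U ^ (2 ℕ.^ suc n))

S-suc : ∀ {n s t} → S n ≡ just ⌊ s ⌋ → ⌊ U ^ (2 ℕ.^ suc n) ⌋ /C ⌊ hprodᶠ (suc n) ⌋ ≡ just ⌊ t ⌋ →
        S (suc n) ≡ just ⌊ s + t ⌋
S-suc {n} {s} {t} Sₙ≡s quotient≡t = begin
  S (suc n)
    ≡⟨ ≡.cong (_>>= λ s′ → summand >>= λ t′ → just (s′ +C t′)) Sₙ≡s ⟩
  (summand >>= λ t′ → just (⌊ s ⌋ +C t′))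
    ≡⟨ ≡.cong (_>>= λ t′ → just (⌊ s ⌋ +C t′)) summand≡t ⟩
  just ⌊ s + t ⌋ ∎
  where
  open ≡.≡-Reasoning
  summand : Maybe C
  summand = (Uc ^C (2 ℕ.^ suc n)) /C hprod (suc n)
  summand≡t : summand ≡ just ⌊ t ⌋
  summand≡t = ≡.trans (≡.cong₂ _/C_ (≡.sym (⌊U^⌋ (2 ℕ.^ suc n))) (≡.sym (⌊hprodᶠ⌋ (suc n)))) quotient≡t

-- S 0 is reached by the same step from the trivial approximant s = 0, P = 1, h = h₀ = T, V = U.
stage : ∀ n → Stage n
stage zero =
  let (t , S₀≡t , t*T≈U) = divide-exactly (U ^ 1) T (hᶠ≉0 0)
      t-def : t * (1# * T) ≈ U
      t-def = trans (*-cong (refl {t}) (*-identityˡ T)) (trans t*T≈U (*-identityʳ U))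
  in t , S₀≡t
   , Iterates-resp {1} (+-identityˡ t) (advance {0} {t = t} iterates-initial approximant-initial 1≉0 (hᶠ≉0 0) t-def)
   , Approximant-resp (+-identityˡ t) (*-identityˡ T) h₁≈ U²≈ (approximant-step {t = t} approximant-initial t-def)
  where
  1≉0 : 1# ≉ 0#
  1≉0 1≈0 = ℚ[T,U]-1≉0 (≃0⇒numer≈0 1≈0)
  U¹≈U : U ^ 1 ≈ U
  U¹≈U = *-identityʳ U
  h₁≈ : T * T - (U + U) ≈ hᶠ 1
  h₁≈ = sym (trans (hᶠ-suc 0) (+-cong (refl {T * T}) (-‿cong (+-cong U¹≈U U¹≈U))))
  U²≈ : U * U ≈ U ^ 2
  U²≈ = sym (trans (U^2^suc 0) (*-cong U¹≈U U¹≈U))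
stage (suc n) =
  let (s , Sₙ≡s , iterates , a) = stage n
      (t , quotient≡t , t-def) = divide-exactly (U ^ (2 ℕ.^ suc n)) (hprodᶠ (suc n)) (hprodᶠ≉0 (suc n))
  in s + t , S-suc {n} {s} {t} Sₙ≡s quotient≡t
   , advance {suc n} {t = t} iterates a (hprodᶠ≉0 n) (hᶠ≉0 (suc n)) t-def
   , Approximant-resp refl refl (sym (hᶠ-suc (suc n))) (sym (U^2^suc (suc n))) (approximant-step {t = t} a t-def)

lemma3p2 : (n : ℕ) → (Fiter (suc n) 0C ≈M S n) × (Fiter (suc n) Tc ≈M map (Tc -C_) (S n))
lemma3p2 n =
  let (s , Sₙ≡s , (x , y , (Fⁿ⁺¹⌊0⌋≡⌊x⌋ , Fⁿ⁺¹⌊T⌋≡⌊y⌋) , x≈s , y≈T-s) , _) = stage n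
  in ≡.subst₂ _≈M_ (≡.sym Fⁿ⁺¹⌊0⌋≡⌊x⌋) (≡.sym Sₙ≡s) (≈⇒≈C x≈s)
   , ≡.subst₂ _≈M_ (≡.sym Fⁿ⁺¹⌊T⌋≡⌊y⌋) (≡.cong (map (Tc -C_)) (≡.sym Sₙ≡s))
                   (≈⇒≈C (trans y≈T-s (sym (-ᶠ≃+ᶠ-ᶠ T s))))
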